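{- Let $\Gamma$ be a finite group and $H$ a subgroup of $\Gamma$. (i) If $|H|\leq(\overline{D}(\Gamma))!$, then $\overline{D}(H)\leq\overline{D}(\Gamma)$. (ii) If $|\Gamma|\leq(\overline{D}(H))!$, then $\overline{D}(\Gamma)\leq\overline{D}(H)$.
   Context: For a group $G$ acting faithfully on a set $X$, $D_G(X)$ is the least $r$ such that there is a surjection $\phi:X\to\{1,\ldots,r\}$ whose only preserving element ($g$ with $\phi(g.x)=\phi(x)$ for all $x$) is the identity. $\overline{D}(G)=\max\{D_G(X):\ G \text{ acts faithfully on } X\}$. -}

module Defs where

open import Level using (0ℓ)
open import Algebra.Bundles using (Group)
open import Algebra.Morphism.Structures using (module GroupMorphisms)
open import Data.Nat using (ℕ; _≤_; _<_)
open import Data.Fin using (Fin)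
open import Data.Product using (Σ; ∃; _×_)
open import Function.Definitions using (Surjective)
open import Relation.Binary.PropositionalEquality using (_≡_)
open import Relation.Nullary using (¬_)

module _ (G : Group 0ℓ 0ℓ) where
  open Group G

  HasOrder : ℕ → Set
  HasOrder n = Σ (Fin n → Carrier) λ f →
    (∀ i j → f i ≈ f j → i ≡ j) × (∀ g → ∃ λ i → f i ≈ g)

  record Action (X : Set) : Set where
    field
      act      : Carrier → X → X
      act-resp : ∀ {g h} → g ≈ h → ∀ x → act g x ≡ act h x
      act-ε    : ∀ x → act ε x ≡ x
      act-∙    : ∀ g h x → act (g ∙ h) x ≡ act g (act h x)

  module _ {X : Set} (A : Action X) where
    open Action A

    Faithful : Set
    Faithful = ∀ g → (∀ x → act g x ≡ x) → g ≈ ε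

    Preserves : ∀ {r} → (X → Fin r) → Carrier → Set
    Preserves φ g = ∀ x → φ (act g x) ≡ φ x

    DistinguishingWith : ℕ → Set
    DistinguishingWith r = Σ (X → Fin r) λ φ →
      Surjective _≡_ _≡_ φ × (∀ g → Preserves φ g → g ≈ ε)

    IsDistNum : ℕ → Set
    IsDistNum r = DistinguishingWith r × (∀ s → s < r → ¬ DistinguishingWith s)

  IsDbar : ℕ → Set₁
  IsDbar d =
    (Σ Set λ X → Σ (Action X) λ A → Faithful A × IsDistNum A d)
    × (∀ (X : Set) (A : Action X) → Faithful A → ∀ r → IsDistNum A r → r ≤ d)

IsSubgroup : (H Γ : Group 0ℓ 0ℓ) → Set
IsSubgroup H Γ = Σ (Group.Carrier H → Group.Carrier Γ) λ ι →
  GroupMorphisms.IsGroupMonomorphism (Group.rawGroup H) (Group.rawGroup Γ) ι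

-- Given a distinguishing colouring φ of X, replace each point y by its signature (φ(h y))_h; the
-- signatures form a finite G-set with decidable equality, and an element fixing the signature of
-- every point preserves φ. For a subgroup K with |K| ≤ (t+1)!, colour the signatures with t+1
-- colours so that only elements fixing all signatures preserve the colouring: if every orbit has at
-- most t+1 points, colour a point by its position in its orbit; otherwise some orbit has at least
-- t+2 points, so by orbit-stabiliser the stabiliser of such a point v has order below t!; give v a
-- fresh colour and recurse on its stabiliser. Finally drop the unused colours. Deciding whether a
-- long orbit exists, or a colour is used, is impossible for an arbitrary type X, but the argument
-- only refutes a smaller distinguishing number, so it may run under double negation.

module Submission where

open import Defs
open import Level using (0ℓ)
open import Algebra.Bundles using (Group)
import Algebra.Properties.Group as GroupProperties
open import Data.Empty using (⊥; ⊥-elim)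
open import Data.Unit using (⊤; tt)
open import Data.Nat using (ℕ; zero; suc; _+_; _*_; _≤_; _<_; z≤n; s≤s; _!; >-nonZero; _≤?_)
open import Data.Nat.DivMod using (_mod_; m<n⇒m%n≡m)
open import Data.Nat.Properties
  using ( module ≤-Reasoning; ≤-refl; ≮⇒≥; <⇒≱; m≤n⇒m≤1+n; <-≤-trans; ≤-<-trans; <⇒≤; ≰⇒>; n≮0
        ; *-monoˡ-<; *-cancelˡ-<)
open import Data.Fin using (Fin; toℕ; punchOut) renaming (zero to fzero; suc to fsuc)
open import Data.Fin.Properties as Fin
  using (punchOut-injective; toℕ-injective; toℕ-fromℕ<; all?; ¬∀⟶∃¬; suc-injective; 0≢1+n)
open import Data.Vec using (Vec; []; _∷_; lookup; tabulate)
open import Data.Vec.Properties using (≡-dec; ∷-injective; lookup∘tabulate; tabulate-cong; tabulate∘lookup)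
open import Data.List using (List; []; _∷_; length; map; _++_; filter; allFin; cartesianProductWith)
open import Data.List.Properties
  using (length-++; length-map; length-removeAt′; length-tabulate; filter-all; filter-≐)
import Data.List.Relation.Unary.All as All
open import Data.List.Relation.Unary.Any using (here; there; index; _─_)
open import Data.List.Relation.Unary.AllPairs as AllPairs using (_∷_)
open import Data.List.Relation.Unary.Unique.Propositional using (Unique)
open import Data.List.Relation.Unary.Unique.Propositional.Properties
  using (cartesianProductWith⁺; filter⁺; allFin⁺)
open import Data.List.Membership.Propositional using (_∈_)
open import Data.List.Membership.Propositional.Properties
  using (∈-cartesianProductWith⁺; ∈-cartesianProductWith⁻; ∈-filter⁺; ∈-filter⁻; ∈-allFin; ∈-map⁺)
open import Data.List.Membership.Setoid.Properties using (index-injective)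
open import Data.List.Relation.Binary.Subset.Propositional using (_⊆_)
open import Data.Product using (Σ; ∃; _×_; _,_; proj₁; proj₂)
open import Data.Product.Properties using (,-injectiveˡ; ,-injectiveʳ)
open import Function.Base using (_∘_)
open import Function.Definitions using (Surjective)
open import Relation.Nullary using (¬_; yes; no)
open import Relation.Nullary.Negation using (¬¬-map)
open import Relation.Nullary.Decidable using (_×-dec_; ¬¬-excluded-middle)
open import Relation.Unary using (Decidable)
open import Relation.Binary.Definitions using (DecidableEquality)
open import Relation.Binary.PropositionalEquality
  using (_≡_; _≢_; refl; sym; trans; cong; cong₂; subst; ≢-sym; setoid; module ≡-Reasoning)
import Relation.Binary.Reasoning.Setoid as ≈-Reasoning

∈-─⁺ : ∀ {A : Set} {x y : A} {ys : List A} (x∈ys : x ∈ ys) → y ∈ ys → y ≢ x → y ∈ (ys ─ x∈ys)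
∈-─⁺ (here refl) (here refl) y≢x = ⊥-elim (y≢x refl)
∈-─⁺ (here _)    (there y∈ys) _  = y∈ys
∈-─⁺ (there _)   (here y≡z) _    = here y≡z
∈-─⁺ (there x∈ys) (there y∈ys) y≢x = there (∈-─⁺ x∈ys y∈ys y≢x)

length-mono-⊆ : ∀ {A : Set} {xs ys : List A} → Unique xs → xs ⊆ ys → length xs ≤ length ys
length-mono-⊆ {xs = []} _ _ = z≤n
length-mono-⊆ {xs = x ∷ xs} {ys} (x∉xs ∷ xs!) xs⊆ys =
  subst (suc (length xs) ≤_) (sym (length-removeAt′ ys (index x∈ys)))
    (s≤s (length-mono-⊆ xs! λ y∈xs → ∈-─⁺ x∈ys (xs⊆ys (there y∈xs)) (≢-sym (All.lookup x∉xs y∈xs))))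
  where x∈ys = xs⊆ys (here refl)

length-cartesianProductWith : ∀ {A B C : Set} (f : A → B → C) xs ys →
  length (cartesianProductWith f xs ys) ≡ length xs * length ys
length-cartesianProductWith f [] ys = refl
length-cartesianProductWith f (x ∷ xs) ys = begin
  length (map (f x) ys ++ cartesianProductWith f xs ys)
    ≡⟨ length-++ (map (f x) ys) ⟩
  length (map (f x) ys) + length (cartesianProductWith f xs ys)
    ≡⟨ cong₂ _+_ (length-map (f x) ys) (length-cartesianProductWith f xs ys) ⟩
  length ys + length xs * length ys
    ∎
  where open ≡-Reasoning

vectors : ∀ {A : Set} → List A → ∀ m → List (Vec A m)
vectors xs zero = [] ∷ []
vectors xs (suc m) = cartesianProductWith _∷_ xs (vectors xs m)

vectors-unique : ∀ {A : Set} {xs : List A} → Unique xs → ∀ m → Unique (vectors xs m)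
vectors-unique xs! zero = All.[] ∷ AllPairs.[]
vectors-unique xs! (suc m) = cartesianProductWith⁺ _∷_ ∷-injective xs! (vectors-unique xs! m)

∈-vectors : ∀ {A : Set} {xs : List A} → (∀ x → x ∈ xs) → ∀ {m} (v : Vec A m) → v ∈ vectors xs m
∈-vectors ∈xs [] = here refl
∈-vectors ∈xs (x ∷ v) = ∈-cartesianProductWith⁺ _∷_ (∈xs x) (∈-vectors ∈xs v)

∈⇒length>0 : ∀ {A : Set} {x : A} {xs : List A} → x ∈ xs → 0 < length xs
∈⇒length>0 (here _)  = s≤s z≤n
∈⇒length>0 (there _) = s≤s z≤n

toℕ-index-injective : ∀ {A : Set} {x y : A} {xs ys : List A} (x∈xs : x ∈ xs) (y∈ys : y ∈ ys) →
                      xs ≡ ys → toℕ (index x∈xs) ≡ toℕ (index y∈ys) → x ≡ y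
toℕ-index-injective x∈xs y∈xs refl eq = index-injective (setoid _) x∈xs y∈xs (toℕ-injective eq)

¬¬-decidable-Fin : ∀ {m} (P : Fin m → Set) → ¬ ¬ Decidable P
¬¬-decidable-Fin {zero} P ¬dec = ¬dec λ ()
¬¬-decidable-Fin {suc m} P ¬dec = ¬¬-excluded-middle λ P0? →
  ¬¬-decidable-Fin (λ i → P (fsuc i)) λ Psuc? →
  ¬dec λ { fzero → P0? ; (fsuc i) → Psuc? i }

¬¬-surjective-refinement : ∀ {Y : Set} {m} (ψ : Y → Fin m) → ¬ ¬ ∃ λ r → r ≤ m ×
  Σ (Y → Fin r) λ χ → Surjective _≡_ _≡_ χ × (∀ x y → χ x ≡ χ y → ψ x ≡ ψ y)
¬¬-surjective-refinement {m = zero} ψ k = k (0 , z≤n , ψ , (λ ()) , λ _ _ eq → eq)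
¬¬-surjective-refinement {Y} {suc m} ψ k = ¬¬-decidable-Fin Used refine
  where
    Used : Fin (suc m) → Set
    Used c = ∃ λ y → ψ y ≡ c

    refine : Decidable Used → ⊥
    refine used? with all? used?
    ... | yes allUsed =
      k (suc m , ≤-refl , ψ , (λ c → proj₁ (allUsed c) , λ { refl → proj₂ (allUsed c) }) , λ _ _ eq → eq)
    ... | no notAllUsed with c , unused ← ¬∀⟶∃¬ (suc m) Used used? notAllUsed =
      ¬¬-surjective-refinement ψ′ λ (r , r≤m , χ , χ-surjective , χ-finer) →
        k (r , m≤n⇒m≤1+n r≤m , χ , χ-surjective ,
           λ x y eq → punchOut-injective (c≢ψ x) (c≢ψ y) (χ-finer x y eq))
      where
        c≢ψ : ∀ y → c ≢ ψ y
        c≢ψ y c≡ψy = unused (y , sym c≡ψy)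
        ψ′ : Y → Fin m
        ψ′ y = punchOut (c≢ψ y)

module EnumeratedGroup (G : Group 0ℓ 0ℓ) {n : ℕ} (ord : HasOrder G n) where
  open Group G using (Carrier; _≈_; _∙_; ε; _⁻¹; assoc; identityʳ; inverseˡ; ∙-congˡ; ∙-congʳ)
    renaming (trans to ≈-trans; sym to ≈-sym)
  open GroupProperties G using (∙-cancelˡ)

  element : Fin n → Carrier
  element = proj₁ ord

  element-injective : ∀ {i j} → element i ≈ element j → i ≡ j
  element-injective = proj₁ (proj₂ ord) _ _

  position : Carrier → Fin n
  position g = proj₁ (proj₂ (proj₂ ord) g)

  element-position : ∀ g → element (position g) ≈ g
  element-position g = proj₂ (proj₂ (proj₂ ord) g)

  position-cong : ∀ {g h} → g ≈ h → position g ≡ position h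
  position-cong {g} {h} g≈h =
    element-injective (≈-trans (element-position g) (≈-trans g≈h (≈-sym (element-position h))))

  position-element : ∀ i → position (element i) ≡ i
  position-element i = element-injective (element-position (element i))

  infixl 7 _·_
  _·_ : Fin n → Fin n → Fin n
  i · j = position (element i ∙ element j)

  e : Fin n
  e = position ε

  inv : Fin n → Fin n
  inv i = position (element i ⁻¹)

  element-· : ∀ i j → element (i · j) ≈ element i ∙ element j
  element-· i j = element-position _

  element-e : element e ≈ ε
  element-e = element-position ε

  ·-assoc : ∀ i j k → (i · j) · k ≡ i · (j · k)
  ·-assoc i j k = position-cong (begin
    element (i · j) ∙ element k       ≈⟨ ∙-congʳ (element-· i j) ⟩
    (element i ∙ element j) ∙ element k ≈⟨ assoc _ _ _ ⟩
    element i ∙ (element j ∙ element k) ≈⟨ ∙-congˡ (element-· j k) ⟨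
    element i ∙ element (j · k)       ∎)
    where open ≈-Reasoning (Group.setoid G)

  ·-identityʳ : ∀ i → i · e ≡ i
  ·-identityʳ i = trans (position-cong (≈-trans (∙-congˡ element-e) (identityʳ _))) (position-element i)

  ·-inverseˡ : ∀ i → inv i · i ≡ e
  ·-inverseˡ i = position-cong (≈-trans (∙-congʳ (element-position _)) (inverseˡ _))

  ·-cancelˡ : ∀ i {j k} → i · j ≡ i · k → j ≡ k
  ·-cancelˡ i {j} {k} eq = element-injective (∙-cancelˡ (element i) _ _ (begin
    element i ∙ element j ≈⟨ element-· i j ⟨
    element (i · j)       ≡⟨ cong element eq ⟩
    element (i · k)       ≈⟨ element-· i k ⟩
    element i ∙ element k ∎))
    where open ≈-Reasoning (Group.setoid G)

  record Subgroup : Set₁ where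
    field
      Member     : Fin n → Set
      member?    : Decidable Member
      e-member   : Member e
      ·-member   : ∀ {i j} → Member i → Member j → Member (i · j)
      inv-member : ∀ {i} → Member i → Member (inv i)

    elements : List (Fin n)
    elements = filter member? (allFin n)

    elements-unique : Unique elements
    elements-unique = filter⁺ member? (allFin⁺ n)

    ∈-elements : ∀ {i} → Member i → i ∈ elements
    ∈-elements = ∈-filter⁺ member? (∈-allFin _)

    ∈-elements⁻ : ∀ {i} → i ∈ elements → Member i
    ∈-elements⁻ i∈elements = proj₂ (∈-filter⁻ member? {xs = allFin n} i∈elements)

    order : ℕ
    order = length elements

    order-positive : 0 < order
    order-positive = ∈⇒length>0 (∈-elements e-member)

  open Subgroup public

  whole : Subgroup
  whole = record
    { Member = λ _ → ⊤ ; member? = λ _ → yes tt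
    ; e-member = tt ; ·-member = λ _ _ → tt ; inv-member = λ _ → tt }

  order-whole : order whole ≡ n
  order-whole = trans (cong length (filter-all (member? whole) {allFin n} (All.tabulate (λ _ → tt))))
                      (length-tabulate (λ i → i))

  module FiniteGSet {V : Set} (_≟_ : DecidableEquality V)
    {points : List V} (points-unique : Unique points) (∈-points : ∀ v → v ∈ points)
    (_▸_ : Fin n → V → V) (▸-identity : ∀ v → e ▸ v ≡ v) (▸-· : ∀ i j v → i ▸ (j ▸ v) ≡ (i · j) ▸ v)
    where

    ▸-inverseˡ : ∀ i v → inv i ▸ (i ▸ v) ≡ v
    ▸-inverseˡ i v = trans (▸-· (inv i) i v) (trans (cong (_▸ v) (·-inverseˡ i)) (▸-identity v))

    ▸-injective : ∀ i {u w} → i ▸ u ≡ i ▸ w → u ≡ w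
    ▸-injective i {u} {w} eq = trans (sym (▸-inverseˡ i u)) (trans (cong (inv i ▸_) eq) (▸-inverseˡ i w))

    module _ (S : Subgroup) where

      InOrbit : V → V → Set
      InOrbit v w = ∃ λ k → Member S k × k ▸ v ≡ w

      inOrbit? : ∀ v → Decidable (InOrbit v)
      inOrbit? v w = Fin.any? λ k → member? S k ×-dec ((k ▸ v) ≟ w)

      orbit : V → List V
      orbit v = filter (inOrbit? v) points

      orbit-unique : ∀ v → Unique (orbit v)
      orbit-unique v = filter⁺ (inOrbit? v) points-unique

      ∈-orbit⁺ : ∀ {v w} → InOrbit v w → w ∈ orbit v
      ∈-orbit⁺ = ∈-filter⁺ (inOrbit? _) (∈-points _)

      ∈-orbit⁻ : ∀ {v w} → w ∈ orbit v → InOrbit v w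
      ∈-orbit⁻ w∈orbit = proj₂ (∈-filter⁻ (inOrbit? _) {xs = points} w∈orbit)

      ∈-orbit-self : ∀ v → v ∈ orbit v
      ∈-orbit-self v = ∈-orbit⁺ (e , e-member S , ▸-identity v)

      orbit-▸ : ∀ {g} → Member S g → ∀ v → orbit (g ▸ v) ≡ orbit v
      orbit-▸ {g} g∈S v = filter-≐ (inOrbit? (g ▸ v)) (inOrbit? v) (to , from) points
        where
          to : ∀ {w} → InOrbit (g ▸ v) w → InOrbit v w
          to (k , k∈S , k▸g▸v≡w) = k · g , ·-member S k∈S g∈S , trans (sym (▸-· k g v)) k▸g▸v≡w
          from : ∀ {w} → InOrbit v w → InOrbit (g ▸ v) w
          from (k , k∈S , k▸v≡w) = k · inv g , ·-member S k∈S (inv-member S g∈S) , (begin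
            (k · inv g) ▸ (g ▸ v)  ≡⟨ ▸-· (k · inv g) g v ⟩
            ((k · inv g) · g) ▸ v  ≡⟨ cong (_▸ v) (·-assoc k (inv g) g) ⟩
            (k · (inv g · g)) ▸ v  ≡⟨ cong (λ h → (k · h) ▸ v) (·-inverseˡ g) ⟩
            (k · e) ▸ v            ≡⟨ cong (_▸ v) (·-identityʳ k) ⟩
            k ▸ v                  ≡⟨ k▸v≡w ⟩
            _                      ∎)
            where open ≡-Reasoning

      stabilizer : V → Subgroup
      stabilizer v = record
        { Member     = λ k → Member S k × k ▸ v ≡ v
        ; member?    = λ k → member? S k ×-dec ((k ▸ v) ≟ v)
        ; e-member   = e-member S , ▸-identity v
        ; ·-member   = λ {i} {j} (i∈S , i▸v≡v) (j∈S , j▸v≡v) →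
            ·-member S i∈S j∈S , trans (sym (▸-· i j v)) (trans (cong (i ▸_) j▸v≡v) i▸v≡v)
        ; inv-member = λ {i} (i∈S , i▸v≡v) →
            inv-member S i∈S , trans (cong (inv i ▸_) (sym i▸v≡v)) (▸-inverseˡ i v)
        }

      representative : V → V → Fin n
      representative v w with inOrbit? v w
      ... | yes (k , _) = k
      ... | no _        = e

      representative-spec : ∀ {v w} → InOrbit v w →
        Member S (representative v w) × representative v w ▸ v ≡ w
      representative-spec {v} {w} v~w with inOrbit? v w
      ... | yes (_ , k∈S , k▸v≡w) = k∈S , k▸v≡w
      ... | no v≁w                = ⊥-elim (v≁w v~w)

      -- With a representative r_w for each orbit point w, (w , s) ↦ (w , r_w · s) embeds
      -- orbit × stabilizer into the graph of k ↦ k ▸ v on S.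
      orbit-stabilizer : ∀ v → length (orbit v) * order (stabilizer v) ≤ order S
      orbit-stabilizer v = begin
        length (orbit v) * order (stabilizer v)
          ≡⟨ length-cartesianProductWith coset (orbit v) (elements (stabilizer v)) ⟨
        length cosets  ≤⟨ length-mono-⊆ cosets-unique cosets⊆graph ⟩
        length graph   ≡⟨ length-map _ (elements S) ⟩
        order S        ∎
        where
          open ≤-Reasoning
          coset : V → Fin n → V × Fin n
          coset w s = w , representative v w · s

          cosets : List (V × Fin n)
          cosets = cartesianProductWith coset (orbit v) (elements (stabilizer v))

          graph : List (V × Fin n)
          graph = map (λ k → k ▸ v , k) (elements S)

          coset-injective : ∀ {w w′ s s′} → coset w s ≡ coset w′ s′ → w ≡ w′ × s ≡ s′
          coset-injective eq with refl ← ,-injectiveˡ eq = refl , ·-cancelˡ _ (,-injectiveʳ eq)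

          cosets-unique : Unique cosets
          cosets-unique =
            cartesianProductWith⁺ coset coset-injective (orbit-unique v) (elements-unique (stabilizer v))

          cosets⊆graph : ∀ {x} → x ∈ cosets → x ∈ graph
          cosets⊆graph x∈cosets
            with w , s , w∈orbit , s∈stab , refl ← ∈-cartesianProductWith⁻ coset (orbit v) _ x∈cosets
            with r∈S , r▸v≡w ← representative-spec (∈-orbit⁻ w∈orbit)
               | s∈S , s▸v≡v ← ∈-elements⁻ (stabilizer v) s∈stab =
            subst (λ u → (u , r · s) ∈ graph) r·s▸v≡w (∈-map⁺ _ (∈-elements S (·-member S r∈S s∈S)))
            where
              r = representative v w
              r·s▸v≡w : (r · s) ▸ v ≡ w
              r·s▸v≡w = trans (sym (▸-· r s v)) (trans (cong (r ▸_) s▸v≡v) r▸v≡w)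

    stabilizer-order-< : ∀ t S v → suc t < length (orbit S v) → order S ≤ suc t ! →
                         order (stabilizer S v) < t !
    stabilizer-order-< t S v long |S|≤ = *-cancelˡ-< (suc t) _ _ (begin-strict
      suc t * order Sᵥ               <⟨ *-monoˡ-< (order Sᵥ) {{>-nonZero (order-positive Sᵥ)}} long ⟩
      length (orbit S v) * order Sᵥ  ≤⟨ orbit-stabilizer S v ⟩
      order S                        ≤⟨ |S|≤ ⟩
      suc t !                        ∎)
      where
        open ≤-Reasoning
        Sᵥ = stabilizer S v

    -- P marks the points to be distinguished; it need not be decidable.
    module Colouring (P : V → Set) where

      Distinguishes : ∀ {m} → Subgroup → (V → Fin m) → Set
      Distinguishes S C =
        ∀ g → Member S g → (∀ {w} → P w → C (g ▸ w) ≡ C w) → ∀ {w} → P w → g ▸ w ≡ w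

      positionInOrbit : Subgroup → V → ℕ
      positionInOrbit S w = toℕ (index (∈-orbit-self S w))

      -- `mod` only wraps positions in orbits longer than t + 1, and these contain no P-point.
      positionColouring : ∀ t S → (∀ {w} → P w → length (orbit S w) ≤ suc t) →
                          Distinguishes S (λ w → positionInOrbit S w mod suc t)
      positionColouring t S short g g∈S preserves {w} Pw =
        toℕ-index-injective (∈-orbit-self S (g ▸ w)) (∈-orbit-self S w) (orbit-▸ S g∈S w) (begin
          positionInOrbit S (g ▸ w)                 ≡⟨ unwrap g▸w-position-< ⟨
          toℕ (positionInOrbit S (g ▸ w) mod suc t) ≡⟨ cong toℕ (preserves Pw) ⟩
          toℕ (positionInOrbit S w mod suc t)       ≡⟨ unwrap (position-< w) ⟩
          positionInOrbit S w                       ∎)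
        where
          open ≡-Reasoning
          position-< : ∀ u → positionInOrbit S u < length (orbit S u)
          position-< u = Fin.toℕ<n (index (∈-orbit-self S u))
          g▸w-position-< : positionInOrbit S (g ▸ w) < length (orbit S w)
          g▸w-position-< =
            subst (λ xs → positionInOrbit S (g ▸ w) < length xs) (orbit-▸ S g∈S w) (position-< (g ▸ w))
          unwrap : ∀ {m} → m < length (orbit S w) → toℕ (m mod suc t) ≡ m
          unwrap m<len = trans (toℕ-fromℕ< _) (m<n⇒m%n≡m (<-≤-trans m<len (short Pw)))

      freshColour : ∀ {m} → V → (V → Fin m) → V → Fin (suc m)
      freshColour v C w with w ≟ v
      ... | yes _ = fzero
      ... | no _  = fsuc (C w)

      freshColour-≡ : ∀ {m} v (C : V → Fin m) → freshColour v C v ≡ fzero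
      freshColour-≡ v C with v ≟ v
      ... | yes _  = refl
      ... | no v≢v = ⊥-elim (v≢v refl)

      freshColour-≢ : ∀ {m v w} (C : V → Fin m) → w ≢ v → freshColour v C w ≡ fsuc (C w)
      freshColour-≢ {v = v} {w} C w≢v with w ≟ v
      ... | yes w≡v = ⊥-elim (w≢v w≡v)
      ... | no _    = refl

      freshColour-distinguishes : ∀ {m S v} {C : V → Fin m} → Distinguishes (stabilizer S v) C →
                                  P v → Distinguishes S (freshColour v C)
      freshColour-distinguishes {S = S} {v} {C} distinguishes Pv g g∈S preserves =
        distinguishes g (g∈S , g▸v≡v) preserves′
        where
          g▸v≡v : g ▸ v ≡ v
          g▸v≡v with (g ▸ v) ≟ v
          ... | yes g▸v≡v = g▸v≡v
          ... | no g▸v≢v  = ⊥-elim (0≢1+n (begin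
            fzero                     ≡⟨ freshColour-≡ v C ⟨
            freshColour v C v         ≡⟨ preserves Pv ⟨
            freshColour v C (g ▸ v)   ≡⟨ freshColour-≢ C g▸v≢v ⟩
            fsuc (C (g ▸ v))          ∎))
            where open ≡-Reasoning

          preserves′ : ∀ {w} → P w → C (g ▸ w) ≡ C w
          preserves′ {w} Pw with w ≟ v
          ... | yes refl = cong C g▸v≡v
          ... | no w≢v   = suc-injective (begin
            fsuc (C (g ▸ w))          ≡⟨ freshColour-≢ C g▸w≢v ⟨
            freshColour v C (g ▸ w)   ≡⟨ preserves Pw ⟩
            freshColour v C w         ≡⟨ freshColour-≢ C w≢v ⟩
            fsuc (C w)                ∎)
            where
              open ≡-Reasoning
              g▸w≢v : g ▸ w ≢ v
              g▸w≢v g▸w≡v = w≢v (▸-injective g (trans g▸w≡v (sym g▸v≡v)))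

      colouring : ∀ t S → order S ≤ suc t ! → ¬ ¬ Σ (V → Fin (suc t)) (Distinguishes S)
      colouring t S |S|≤ k = ¬¬-excluded-middle {A = ∃ λ v → P v × suc t < length (orbit S v)} λ
        { (no noLongOrbit) → k (_ , positionColouring t S λ Pw → ≮⇒≥ λ long → noLongOrbit (_ , Pw , long))
        ; (yes (v , Pv , long)) → viaStabilizer t Pv (stabilizer-order-< t S v long |S|≤) k
        }
        where
          viaStabilizer : ∀ m {v} → P v → order (stabilizer S v) < m ! →
                          ¬ ¬ Σ (V → Fin (suc m)) (Distinguishes S)
          viaStabilizer zero {v} _ |Sᵥ|<1 = ⊥-elim (<⇒≱ |Sᵥ|<1 (order-positive (stabilizer S v)))
          viaStabilizer (suc m) {v} Pv |Sᵥ|<m! = ¬¬-map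
            (λ (C , distinguishes) → freshColour v C , freshColour-distinguishes {S = S} distinguishes Pv)
            (colouring m (stabilizer S v) (<⇒≤ |Sᵥ|<m!))

  module Signatures {Y : Set} (A : Action G Y) {d : ℕ} (φ : Y → Fin d) where
    open Action A

    Signature : Set
    Signature = Vec (Fin d) n

    signature : Y → Signature
    signature y = tabulate λ h → φ (act (element h) y)

    _▸_ : Fin n → Signature → Signature
    k ▸ v = tabulate λ h → lookup v (h · k)

    ▸-identity : ∀ v → e ▸ v ≡ v
    ▸-identity v = trans (tabulate-cong λ h → cong (lookup v) (·-identityʳ h)) (tabulate∘lookup v)

    ▸-· : ∀ i j v → i ▸ (j ▸ v) ≡ (i · j) ▸ v
    ▸-· i j v = tabulate-cong λ h → trans (lookup∘tabulate _ (h · i)) (cong (lookup v) (·-assoc h i j))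

    signature-act : ∀ k y → signature (act (element k) y) ≡ k ▸ signature y
    signature-act k y = tabulate-cong λ h → begin
      φ (act (element h) (act (element k) y))  ≡⟨ cong φ (act-∙ (element h) (element k) y) ⟨
      φ (act (element h ∙ element k) y)        ≡⟨ cong φ (act-resp (element-· h k) y) ⟨
      φ (act (element (h · k)) y)              ≡⟨ lookup∘tabulate _ (h · k) ⟨
      lookup (signature y) (h · k)             ∎
      where open ≡-Reasoning

    lookup-signature : ∀ y → lookup (signature y) e ≡ φ y
    lookup-signature y = trans (lookup∘tabulate _ e) (cong φ (trans (act-resp element-e y) (act-ε y)))

    open FiniteGSet (≡-dec Fin._≟_) (vectors-unique (allFin⁺ d) n) (∈-vectors ∈-allFin) _▸_ ▸-identity ▸-·
    open Colouring (λ v → ∃ λ y → signature y ≡ v)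

    recolouring : (∀ g → Preserves G A φ g → g ≈ ε) → ∀ t → n ≤ suc t ! →
                  ¬ ¬ Σ (Y → Fin (suc t)) λ χ → ∀ g → Preserves G A χ g → g ≈ ε
    recolouring φ-distinguishes t n≤ =
      ¬¬-map (λ (C , distinguishes) → C ∘ signature , λ g preserves → φ-distinguishes g λ y → begin
          φ (act g y)                     ≡⟨ lookup-signature (act g y) ⟨
          lookup (signature (act g y)) e  ≡⟨ cong (λ v → lookup v e) (fixes distinguishes g preserves y) ⟩
          lookup (signature y) e          ≡⟨ lookup-signature y ⟩
          φ y                             ∎)
        (colouring t whole (subst (_≤ suc t !) (sym order-whole) n≤))
      where
        open ≡-Reasoning
        fixes : ∀ {C} → Distinguishes whole C → ∀ g → Preserves G A (C ∘ signature) g →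
                ∀ y → signature (act g y) ≡ signature y
        fixes {C} distinguishes g preserves y =
          trans signature-act-g (distinguishes k tt preserves′ (y , refl))
          where
            k = position g
            signature-act-g : ∀ {y} → signature (act g y) ≡ k ▸ signature y
            signature-act-g {y} =
              trans (cong signature (act-resp (≈-sym (element-position g)) y)) (signature-act k y)
            preserves′ : ∀ {w} → (∃ λ y → signature y ≡ w) → C (k ▸ w) ≡ C w
            preserves′ (y , refl) = trans (cong C (sym signature-act-g)) (preserves y)

distinguishingNumber-≤ : ∀ (G : Group 0ℓ 0ℓ) {n} → HasOrder G n → ∀ {t} → n ≤ suc t ! →
                         ∀ {Y} (A : Action G Y) {r} → IsDistNum G A r → r ≤ suc t
distinguishingNumber-≤ G ord {t} n≤ A {r} ((φ , _ , φ-distinguishes) , minimal) with r ≤? suc t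
... | yes r≤ = r≤
... | no r≰ = ⊥-elim (recolouring φ-distinguishes t n≤ λ (χ , χ-distinguishes) →
    ¬¬-surjective-refinement χ λ (r′ , r′≤ , χ′ , χ′-surjective , χ′-finer) →
      minimal r′ (≤-<-trans r′≤ (≰⇒> r≰))
        (χ′ , χ′-surjective , λ g preserves → χ-distinguishes g λ y → χ′-finer _ _ (preserves y)))
  where open EnumeratedGroup G ord using (module Signatures)
        open Signatures A φ using (recolouring)

module _ (G : Group 0ℓ 0ℓ) where
  open Group G using (_≈_; ε)

  trivialAction : Action G ⊤
  trivialAction = record
    { act = λ _ x → x ; act-resp = λ _ _ → refl ; act-ε = λ _ → refl ; act-∙ = λ _ _ _ → refl }

  trivialAction-distNum : (∀ g → g ≈ ε) → IsDistNum G trivialAction 1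
  trivialAction-distNum trivial =
    ((λ _ → fzero) , (λ { fzero → tt , λ _ → refl }) , λ g _ → trivial g) ,
    λ { zero _ (φ , _) → Fin.¬Fin0 (φ tt) ; (suc _) (s≤s ()) }

  IsDbar-positive : ∀ {d} → IsDbar G d → 0 < d
  IsDbar-positive {suc d} _ = s≤s z≤n
  IsDbar-positive {zero} ((X , A , faithful , ((φ , _) , _)) , maximal) =
    ⊥-elim (n≮0 (maximal ⊤ trivialAction (λ g _ → trivial g) 1 (trivialAction-distNum trivial)))
    where
      trivial : ∀ g → g ≈ ε
      trivial g = faithful g λ x → ⊥-elim (Fin.¬Fin0 (φ x))

  IsDbar-≤ : ∀ {n d s} → HasOrder G n → 0 < s → n ≤ s ! → IsDbar G d → d ≤ s
  IsDbar-≤ ord (s≤s z≤n) n≤ ((_ , A , _ , d-distNum) , _) = distinguishingNumber-≤ G ord n≤ A d-distNum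

mainTheorem7 : (Γ H : Group 0ℓ 0ℓ) (n m : ℕ) → HasOrder Γ n → HasOrder H m →
    IsSubgroup H Γ → (dΓ dH : ℕ) → IsDbar Γ dΓ → IsDbar H dH →
    (m ≤ dΓ ! → dH ≤ dΓ) × (n ≤ dH ! → dΓ ≤ dH)
mainTheorem7 Γ H n m |Γ|≡n |H|≡m _ dΓ dH D̄Γ D̄H =
  (λ m≤dΓ! → IsDbar-≤ H |H|≡m (IsDbar-positive Γ D̄Γ) m≤dΓ! D̄H) ,
  (λ n≤dH! → IsDbar-≤ Γ |Γ|≡n (IsDbar-positive H D̄H) n≤dH! D̄Γ)
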